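{- For every maximum cut $(A,B)$ of a chemical graph $G$, the underlying multigraph of $G$ with respect to $(A,B)$ is bipartite.
   Context: Graphs are finite and simple; a chemical graph is a connected graph of maximum degree at most $3$. A cut $(A,B)$ is a partition of $V(G)$; it is maximum if the number of edges between $A$ and $B$ is maximum. The underlying multigraph $M$ of $G$ with respect to $(A,B)$ is the multigraph whose vertex set is the set of edges of $G[A]\cup G[B]$, in which, for two such edges $\alpha,\beta$, exactly $k$ parallel edges join $\alpha$ and $\beta$, where $k$ is the number of edges of $G$ with one end in (the endpoint set of) $\alpha$ and the other in $\beta$. -}

module Defs where

open import Data.Nat using (ℕ; zero; suc; _+_; _≤_)
open import Data.Fin using (Fin; zero; suc; _<_)
open import Data.Bool using (Bool; true; false; if_then_else_; _∧_; _xor_)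
open import Data.Product using (Σ; _×_; ∃; ∃-syntax; _,_)
open import Data.Sum using (_⊎_)
open import Relation.Binary.PropositionalEquality using (_≡_; _≢_)
open import Relation.Nullary using (¬_)

count : ∀ {n} → (Fin n → Bool) → ℕ
count {zero}  f = 0
count {suc n} f = (if f zero then 1 else 0) + count (λ i → f (suc i))

sumF : ∀ {n} → (Fin n → ℕ) → ℕ
sumF {zero}  f = 0
sumF {suc n} f = f zero + sumF (λ i → f (suc i))

record Graph (n : ℕ) : Set where
  field
    adj     : Fin n → Fin n → Bool
    symm    : ∀ i j → adj i j ≡ adj j i
    irrefl  : ∀ i → adj i i ≡ false

open Graph public

data Walk {n : ℕ} (G : Graph n) : Fin n → Fin n → Set where
  here : ∀ {u} → Walk G u u
  step : ∀ {u v w} → adj G u v ≡ true → Walk G v w → Walk G u w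

Connected : ∀ {n} → Graph n → Set
Connected {n} G = Fin n × (∀ u v → Walk G u v)

degree : ∀ {n} → Graph n → Fin n → ℕ
degree G v = count (adj G v)

Chemical : ∀ {n} → Graph n → Set
Chemical G = Connected G × (∀ v → degree G v ≤ 3)

-- a cut (A,B): A = {v | S v ≡ true}, B = {v | S v ≡ false}
Cut : ℕ → Set
Cut n = Fin n → Bool

-- twice the number of edges between A and B (counted as ordered pairs)
cutSize2 : ∀ {n} → Graph n → Cut n → ℕ
cutSize2 G S = sumF (λ i → count (λ j → adj G i j ∧ (S i xor S j)))

MaximumCut : ∀ {n} → Graph n → Cut n → Set
MaximumCut G S = ∀ (S' : Cut _) → cutSize2 G S' ≤ cutSize2 G S

-- (u , v) with u < v is an edge of G[A] ∪ G[B]: a vertex of the underlying multigraph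
InnerEdge : ∀ {n} → Graph n → Cut n → Fin n → Fin n → Set
InnerEdge G S u v = (u < v) × (adj G u v ≡ true) × (S u ≡ S v)

_∈ₑ_ : ∀ {n} → Fin n → Fin n × Fin n → Set
x ∈ₑ (u , v) = (x ≡ u) ⊎ (x ≡ v)

-- number of parallel edges of M joining α and β is positive, i.e.
-- α ≠ β and some edge of G has one end in α and the other in β
MAdjacent : ∀ {n} → Graph n → Fin n × Fin n → Fin n × Fin n → Set
MAdjacent G α β = (α ≢ β) × (∃[ x ] ∃[ y ] (x ∈ₑ α × y ∈ₑ β × adj G x y ≡ true))

-- the underlying multigraph M of G w.r.t. (A,B) is bipartite:
-- a 2-colouring of its vertices such that every edge of M joins distinct colours
UnderlyingBipartite : ∀ {n} → Graph n → Cut n → Set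
UnderlyingBipartite {n} G S =
  Σ (Fin n → Fin n → Bool) λ c →
    ∀ u v u' v' → InnerEdge G S u v → InnerEdge G S u' v' →
      MAdjacent G (u , v) (u' , v') → c u v ≢ c u' v'

-- In a maximum cut, a vertex w of degree at most 3 has at most one neighbour on its own side.
-- Otherwise at most one edge at w crosses the cut and moving w to the other side makes at least
-- two cross; only the edges at w change, so the cut grows. Now colour each edge inside A or B by
-- its side. If an edge xy of G joins such edges α ∋ x and β ∋ y of the same colour, then y and
-- the other end of α are same-side neighbours of x, hence equal; symmetrically x is the other end
-- of β, so α and β have the same ends and α = β.
module Submission where

open import Defs
open import Data.Nat using (ℕ; zero; suc; _+_; _≤_; _<_; z≤n; s≤s)
open import Data.Nat.Properties
  using ( +-0-commutativeMonoid; +-commutativeSemigroup; +-assoc; +-cancelʳ-≡; +-cancelʳ-≤; +-cancelʳ-<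
        ; +-monoʳ-≤; +-monoʳ-<; +-mono-<; ≤-trans; ≤-reflexive; <-≤-trans; <⇒≱; m≤n+m)
open import Data.Fin as Fin using (Fin; zero; suc; punchIn)
open import Data.Fin.Properties using (_≟_; punchInᵢ≢i; <-asym)
open import Data.Vec.Functional using (updateAt; removeAt)
open import Data.Vec.Functional.Properties using (updateAt-updates; updateAt-minimal)
open import Data.Bool using (Bool; true; false; if_then_else_; _∧_; _xor_; not)
open import Data.Bool.Properties using (xor-comm; xor-same; not-distribˡ-xor)
open import Data.Product using (_×_; ∃-syntax; _,_; proj₁)
open import Data.Sum using (_⊎_; inj₁; inj₂)
open import Data.Empty using (⊥-elim)
open import Function using (_∘_)
open import Relation.Nullary using (yes; no; contradiction)
open import Relation.Binary.PropositionalEquality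
open import Algebra.Properties.CommutativeMonoid.Sum +-0-commutativeMonoid
  using (sum; sum-remove; sum-cong-≗; ∑-distrib-+)
open import Algebra.Properties.CommutativeSemigroup +-commutativeSemigroup
  using (xy∙z≈zy∙x)
open ≡-Reasoning

sumF≡sum : ∀ {n} (f : Fin n → ℕ) → sumF f ≡ sum f
sumF≡sum {zero}  f = refl
sumF≡sum {suc n} f = cong (f zero +_) (sumF≡sum (f ∘ suc))

sumF-cong : ∀ {n} {f g : Fin n → ℕ} → (∀ i → f i ≡ g i) → sumF f ≡ sumF g
sumF-cong {f = f} {g} f≗g = begin
  sumF f ≡⟨ sumF≡sum f ⟩
  sum f  ≡⟨ sum-cong-≗ f≗g ⟩
  sum g  ≡⟨ sumF≡sum g ⟨
  sumF g ∎

sumF-distrib-+ : ∀ {n} (f g : Fin n → ℕ) → sumF (λ i → f i + g i) ≡ sumF f + sumF g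
sumF-distrib-+ f g = begin
  sumF (λ i → f i + g i) ≡⟨ sumF≡sum (λ i → f i + g i) ⟩
  sum (λ i → f i + g i)  ≡⟨ ∑-distrib-+ f g ⟩
  sum f + sum g          ≡⟨ cong₂ _+_ (sumF≡sum f) (sumF≡sum g) ⟨
  sumF f + sumF g        ∎

sumF-agreeOff : ∀ {n} (f g : Fin n → ℕ) (w : Fin n) → (∀ j → j ≢ w → f j ≡ g j) →
                sumF f + g w ≡ sumF g + f w
sumF-agreeOff {suc n} f g w f≡g = begin
  sumF f + g w                     ≡⟨ cong (_+ g w) (trans (sumF≡sum f) (sum-remove f)) ⟩
  (f w + sum (removeAt f w)) + g w ≡⟨ cong (λ r → (f w + r) + g w) rest ⟩
  (f w + sum (removeAt g w)) + g w ≡⟨ xy∙z≈zy∙x (f w) _ (g w) ⟩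
  (g w + sum (removeAt g w)) + f w ≡⟨ cong (_+ f w) (trans (sumF≡sum g) (sum-remove g)) ⟨
  sumF g + f w                     ∎
  where
  rest : sum (removeAt f w) ≡ sum (removeAt g w)
  rest = sum-cong-≗ (λ j → f≡g (punchIn w j) (punchInᵢ≢i w j))

sumF²-agreeOffCross : ∀ {n} (f g : Fin n → Fin n → ℕ) (w : Fin n) →
  (∀ i j → i ≢ w → j ≢ w → f i j ≡ g i j) → f w w ≡ g w w →
  sumF (λ i → sumF (f i)) + sumF (λ i → g i w) + sumF (g w) ≡
  sumF (λ i → sumF (g i)) + sumF (λ i → f i w) + sumF (f w)
sumF²-agreeOffCross f g w f≡g fww≡gww = +-cancelʳ-≡ (f w w) _ _ (begin
  Σf + colg + rowg + f w w
    ≡⟨ +-assoc (Σf + colg) rowg (f w w) ⟩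
  (Σf + colg) + (rowg + f w w)
    ≡⟨ cong (_+ (rowg + f w w)) (sumF-distrib-+ (sumF ∘ f) (λ i → g i w)) ⟨
  sumF F + G w
    ≡⟨ sumF-agreeOff F G w rows ⟩
  sumF G + F w
    ≡⟨ cong₂ _+_ (sumF-distrib-+ (sumF ∘ g) (λ i → f i w)) (cong (rowf +_) (sym fww≡gww)) ⟩
  (Σg + colf) + (rowf + f w w)
    ≡⟨ +-assoc (Σg + colf) rowf (f w w) ⟨
  Σg + colf + rowf + f w w ∎)
  where
  Σf Σg rowf rowg colf colg : ℕ
  Σf = sumF (λ i → sumF (f i))
  Σg = sumF (λ i → sumF (g i))
  rowf = sumF (f w)
  rowg = sumF (g w)
  colf = sumF (λ i → f i w)
  colg = sumF (λ i → g i w)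
  F G : Fin _ → ℕ
  F i = sumF (f i) + g i w
  G i = sumF (g i) + f i w
  rows : ∀ i → i ≢ w → F i ≡ G i
  rows i i≢w = sumF-agreeOff (f i) (g i) w (λ j → f≡g i j i≢w)

indicator : Bool → ℕ
indicator b = if b then 1 else 0

count≡sumF : ∀ {n} (p : Fin n → Bool) → count p ≡ sumF (indicator ∘ p)
count≡sumF {zero}  p = refl
count≡sumF {suc n} p = cong (indicator (p zero) +_) (count≡sumF (p ∘ suc))

count-pos : ∀ {n} (p : Fin n → Bool) {i} → p i ≡ true → 1 ≤ count p
count-pos p {zero}  pi rewrite pi = s≤s z≤n
count-pos p {suc i} pi = ≤-trans (count-pos (p ∘ suc) pi) (m≤n+m _ (indicator (p zero)))

count-≥2 : ∀ {n} (p : Fin n → Bool) {i j} → i ≢ j → p i ≡ true → p j ≡ true → 2 ≤ count p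
count-≥2 p {zero}  {zero}  i≢j _  _  = contradiction refl i≢j
count-≥2 p {zero}  {suc j} _   pi pj rewrite pi = s≤s (count-pos (p ∘ suc) pj)
count-≥2 p {suc i} {zero}  _   pi pj rewrite pj = s≤s (count-pos (p ∘ suc) pi)
count-≥2 p {suc i} {suc j} i≢j pi pj =
  ≤-trans (count-≥2 (p ∘ suc) (i≢j ∘ cong suc) pi pj) (m≤n+m _ (indicator (p zero)))

indicator-∧-split : ∀ a b → indicator (a ∧ b) + indicator (a ∧ not b) ≡ indicator a
indicator-∧-split false b     = refl
indicator-∧-split true  false = refl
indicator-∧-split true  true  = refl

flipAt : ∀ {n} → Fin n → Cut n → Cut n
flipAt w S = updateAt S w not

module _ {n} (G : Graph n) where

  crossing : Cut n → Fin n → Fin n → Bool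
  crossing S i j = adj G i j ∧ (S i xor S j)

  cutDegree : Cut n → Fin n → ℕ
  cutDegree S i = count (crossing S i)

  crossing-sym : ∀ S i j → crossing S i j ≡ crossing S j i
  crossing-sym S i j = cong₂ _∧_ (symm G i j) (xor-comm (S i) (S j))

  crossing-diag : ∀ S i → crossing S i i ≡ false
  crossing-diag S i = cong (_∧ _) (irrefl G i)

  crossing-flipAt-off : ∀ S {w} i j → i ≢ w → j ≢ w → crossing (flipAt w S) i j ≡ crossing S i j
  crossing-flipAt-off S {w} i j i≢w j≢w =
    cong₂ (λ x y → adj G i j ∧ (x xor y)) (updateAt-minimal i w S i≢w) (updateAt-minimal j w S j≢w)

  crossing-flipAt-row : ∀ S w j → crossing (flipAt w S) w j ≡ adj G w j ∧ not (S w xor S j)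
  crossing-flipAt-row S w j with j ≟ w
  ... | yes refl rewrite irrefl G w = refl
  ... | no j≢w = begin
    adj G w j ∧ (flipAt w S w xor flipAt w S j)
      ≡⟨ cong₂ (λ x y → adj G w j ∧ (x xor y)) (updateAt-updates w S) (updateAt-minimal j w S j≢w) ⟩
    adj G w j ∧ (not (S w) xor S j)
      ≡⟨ cong (adj G w j ∧_) (not-distribˡ-xor (S w) (S j)) ⟨
    adj G w j ∧ not (S w xor S j) ∎

  cutDegree-flipAt : ∀ S w → cutDegree S w + cutDegree (flipAt w S) w ≡ degree G w
  cutDegree-flipAt S w = begin
    count (crossing S w) + count (crossing (flipAt w S) w)
      ≡⟨ cong₂ _+_ (count≡sumF (crossing S w)) (count≡sumF (crossing (flipAt w S) w)) ⟩
    sumF (indicator ∘ crossing S w) + sumF (indicator ∘ crossing (flipAt w S) w)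
      ≡⟨ sumF-distrib-+ (indicator ∘ crossing S w) (indicator ∘ crossing (flipAt w S) w) ⟨
    sumF (λ j → indicator (crossing S w j) + indicator (crossing (flipAt w S) w j))
      ≡⟨ sumF-cong split ⟩
    sumF (indicator ∘ adj G w)
      ≡⟨ count≡sumF (adj G w) ⟨
    degree G w ∎
    where
    split : ∀ j → indicator (crossing S w j) + indicator (crossing (flipAt w S) w j) ≡
                  indicator (adj G w j)
    split j rewrite crossing-flipAt-row S w j = indicator-∧-split (adj G w j) (S w xor S j)

  crossing-flipAt-sameSide : ∀ S {w j} → adj G w j ≡ true → S w ≡ S j →
                             crossing (flipAt w S) w j ≡ true
  crossing-flipAt-sameSide S {w} {j} wj Sw≡Sj
    rewrite crossing-flipAt-row S w j | wj | Sw≡Sj | xor-same (S j) = refl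

  cutSize2-flipAt : ∀ S w →
    cutSize2 G S + cutDegree (flipAt w S) w + cutDegree (flipAt w S) w ≡
    cutSize2 G (flipAt w S) + cutDegree S w + cutDegree S w
  cutSize2-flipAt S w = begin
    cutSize2 G S + cutDegree S' w + cutDegree S' w
      ≡⟨ asSums S S' ⟨
    sumF (λ i → sumF (f S i)) + sumF (λ i → f S' i w) + sumF (f S' w)
      ≡⟨ sumF²-agreeOffCross (f S) (f S') w off diag ⟩
    sumF (λ i → sumF (f S' i)) + sumF (λ i → f S i w) + sumF (f S w)
      ≡⟨ asSums S' S ⟩
    cutSize2 G S' + cutDegree S w + cutDegree S w ∎
    where
    S' : Cut n
    S' = flipAt w S
    f : Cut n → Fin n → Fin n → ℕ
    f T i j = indicator (crossing T i j)
    asSums : ∀ T T' → sumF (λ i → sumF (f T i)) + sumF (λ i → f T' i w) + sumF (f T' w) ≡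
                      cutSize2 G T + cutDegree T' w + cutDegree T' w
    asSums T T' = cong₂ _+_
      (cong₂ _+_ (sumF-cong (λ i → sym (count≡sumF (crossing T i))))
                 (trans (sumF-cong (λ i → cong indicator (crossing-sym T' i w)))
                        (sym (count≡sumF (crossing T' w)))))
      (sym (count≡sumF (crossing T' w)))
    off : ∀ i j → i ≢ w → j ≢ w → f S i j ≡ f S' i j
    off i j i≢w j≢w = cong indicator (sym (crossing-flipAt-off S i j i≢w j≢w))
    diag : f S w w ≡ f S' w w
    diag = cong indicator (trans (crossing-diag S w) (sym (crossing-diag S' w)))

  flipAt-increases-cut : ∀ S w → cutDegree S w < cutDegree (flipAt w S) w →
                         cutSize2 G S < cutSize2 G (flipAt w S)
  flipAt-increases-cut S w r<r' =
    +-cancelʳ-< r _ _ (+-cancelʳ-< r _ _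
      (<-≤-trans (+-mono-< (+-monoʳ-< (cutSize2 G S) r<r') r<r')
                 (≤-reflexive (cutSize2-flipAt S w))))
    where
    r : ℕ
    r = cutDegree S w

  maximumCut-sameSideNeighbour-unique : (∀ v → degree G v ≤ 3) → ∀ {S} → MaximumCut G S →
    ∀ {w j k} → adj G w j ≡ true → adj G w k ≡ true → S w ≡ S j → S w ≡ S k → j ≡ k
  maximumCut-sameSideNeighbour-unique degree≤3 {S} maxCut {w} {j} {k} wj wk sj sk with j ≟ k
  ... | yes j≡k = j≡k
  ... | no j≢k  = contradiction (maxCut (flipAt w S)) (<⇒≱ (flipAt-increases-cut S w r<r'))
    where
    r r' : ℕ
    r = cutDegree S w
    r' = cutDegree (flipAt w S) w
    2≤r' : 2 ≤ r'
    2≤r' = count-≥2 (crossing (flipAt w S) w) j≢k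
             (crossing-flipAt-sameSide S wj sj) (crossing-flipAt-sameSide S wk sk)
    r+r'≤3 : r + r' ≤ 3
    r+r'≤3 = subst (_≤ 3) (sym (cutDegree-flipAt S w)) (degree≤3 w)
    r<r' : r < r'
    r<r' = <-≤-trans (s≤s (+-cancelʳ-≤ 2 r 1 (≤-trans (+-monoʳ-≤ r 2≤r') r+r'≤3))) 2≤r'

Ends : ∀ {n} → Fin n × Fin n → Fin n → Fin n → Set
Ends α x y = α ≡ (x , y) ⊎ α ≡ (y , x)

innerEdge-partner : ∀ {n} (G : Graph n) {S u v x} → InnerEdge G S u v → x ∈ₑ (u , v) →
  ∃[ x' ] (adj G x x' ≡ true × S u ≡ S x × S x ≡ S x' × Ends (u , v) x x')
innerEdge-partner G {v = v} (_ , uv , Su≡Sv) (inj₁ refl) = v , uv , refl , Su≡Sv , inj₁ refl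
innerEdge-partner G {u = u} (_ , uv , Su≡Sv) (inj₂ refl) =
  u , trans (symm G _ u) uv , Su≡Sv , sym Su≡Sv , inj₂ refl

sortedEnds-unique : ∀ {n} {u v u' v' x y : Fin n} → u Fin.< v → u' Fin.< v' →
  Ends (u , v) x y → Ends (u' , v') y x → (u , v) ≡ (u' , v')
sortedEnds-unique x<y y<x (inj₁ refl) (inj₁ refl) = ⊥-elim (<-asym x<y y<x)
sortedEnds-unique _   _   (inj₁ refl) (inj₂ refl) = refl
sortedEnds-unique _   _   (inj₂ refl) (inj₁ refl) = refl
sortedEnds-unique y<x x<y (inj₂ refl) (inj₂ refl) = ⊥-elim (<-asym y<x x<y)

proposition4p9 : ∀ (n : ℕ) (G : Graph n) → Chemical G →
    ∀ (S : Cut n) → MaximumCut G S → UnderlyingBipartite G S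
proposition4p9 n G (_ , degree≤3) S maxCut = (λ u v → S u) , sidesDiffer
  where
  unique : ∀ {w j k} → adj G w j ≡ true → adj G w k ≡ true → S w ≡ S j → S w ≡ S k → j ≡ k
  unique = maximumCut-sameSideNeighbour-unique G degree≤3 maxCut
  sidesDiffer : ∀ u v u' v' → InnerEdge G S u v → InnerEdge G S u' v' →
                MAdjacent G (u , v) (u' , v') → S u ≢ S u'
  sidesDiffer u v u' v' α β (α≢β , x , y , x∈α , y∈β , xy) Su≡Su'
    with innerEdge-partner G α x∈α | innerEdge-partner G β y∈β
  ... | x' , xx' , Su≡Sx , Sx≡Sx' , α-ends | y' , yy' , Su'≡Sy , Sy≡Sy' , β-ends =
    α≢β (sortedEnds-unique (proj₁ α) (proj₁ β)
          (subst (Ends (u , v) x) (sym y≡x') α-ends) (subst (Ends (u' , v') y) (sym x≡y') β-ends))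
    where
    Sx≡Sy : S x ≡ S y
    Sx≡Sy = trans (sym Su≡Sx) (trans Su≡Su' Su'≡Sy)
    y≡x' : y ≡ x'
    y≡x' = unique xy xx' Sx≡Sy Sx≡Sx'
    x≡y' : x ≡ y'
    x≡y' = unique (trans (symm G y x) xy) yy' (sym Sx≡Sy) Sy≡Sy'
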